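{- Let $q \geq 2$ be a fixed integer. Let $j = j(r) \geq 0$ be a real-valued function defined for positive integers $r$ such that $(1-1/q)r - j(r)$ is a positive integer, and suppose $j(r) = o\left(r^{1/3}\right)$ as $r \to \infty$. Then \[ A_q\left( r, \left( 1 - 1/q \right) r - j \right) \leq \left(2 + o(1)\right) (q - 1)\, r \quad \text{as } r\to\infty. \]
   Context: Let $[q] = \{1,\dots,q\}$. A subset $C \subseteq [q]^r$ is a $q$-ary code with block length $r$ and distance $s$ if any two distinct $x, y \in C$ differ in at least $s$ coordinates. $A_q(r,s)$ denotes the maximum size of such a code. -}

module Defs where

open import Data.Nat using (ℕ; zero; suc; _+_; _≤_)
open import Data.Fin using (Fin; _≟_)
open import Data.Vec using (Vec; []; _∷_)
open import Data.List using (List)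
open import Data.List.Relation.Unary.AllPairs using (AllPairs)
open import Data.Product using (_×_)
open import Relation.Binary.PropositionalEquality using (_≢_)
open import Relation.Nullary.Decidable using (Dec; yes; no)

hamming : ∀ {q r} → Vec (Fin q) r → Vec (Fin q) r → ℕ
hamming [] [] = 0
hamming (x ∷ xs) (y ∷ ys) with x ≟ y
... | yes _ = hamming xs ys
... | no _ = suc (hamming xs ys)

-- A q-ary code of block length r and distance s, given as a list of its
-- codewords: any two entries at distinct list positions are distinct words
-- differing in at least s coordinates (so the list has no repetitions).
IsCode : (q r s : ℕ) → List (Vec (Fin q) r) → Set
IsCode q r s C = AllPairs (λ x y → x ≢ y × s ≤ hamming x y) C

{-# OPTIONS --safe #-}
module Submission where

-- Map each word x ∈ [q]^r to the integer vector v_x with entries v_x(p, a) = q [x_p = a] - 1.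
-- These vectors lie in the subspace of ℤ^(r×q) with vanishing block sums, of dimension
-- n = (q - 1) r, and ⟨v_x, v_y⟩ = q (n - q d(x, y)); so for a code of distance s the Gram
-- matrix G has diagonal N = q n and off-diagonal entries at most A = q t, where t = n - q s.
-- The rank bound (tr G)² ≤ n ‖G‖² is played against an upper bound for ‖G‖²: positive
-- entries are at most A, while the negative entries of a row, which can be as large as -N,
-- are controlled by Cauchy-Schwarz against a weighted sum of the v_x and by a Bessel-type
-- inequality for nearly orthogonal vectors. For M ≤ 4n codewords this gives M ≤ 2n + 31 t³,
-- and a larger code would contain one of size exactly 4n. Since t = q j and j³ = o(r), the
-- bound is (2 + o(1)) n.

open import Defs

module GramMatrixBound where

  open import Data.Nat as ℕ using (ℕ; zero; suc)
  import Data.Nat.Properties as ℕₚ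
  open import Data.Fin using (Fin; zero; suc; _≟_)
  open import Data.Vec using (Vec; []; _∷_; lookup)
  open import Data.List as List using (List)
  import Data.List.Relation.Unary.All as All
  open import Data.List.Relation.Unary.AllPairs using (AllPairs; _∷_)
  open import Data.List.Membership.Propositional.Properties using (∈-lookup)
  open import Data.Product using (_×_; _,_; proj₁; proj₂)
  open import Data.Sum using (inj₁; inj₂)
  open import Data.Bool using (true; false; if_then_else_)
  open import Data.Integer
    using (ℤ; +_; +[1+_]; -[1+_]; +0; _+_; _*_; -_; _-_; _≤_; _<_; 0ℤ; 1ℤ; +≤+; +<+; nonNegative; positive)
  open import Data.Integer.Properties hiding (_≟_)
  open import Data.Integer.Tactic.RingSolver using (solve-∀)
  open import Algebra.Properties.Semiring.Sum +-*-semiring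
    using (sum; sum-syntax; sum-cong-≗; ∑-distrib-+; *-distribˡ-sum; *-distribʳ-sum)
  open import Function using (_∘_)
  open import Relation.Binary.PropositionalEquality
  open import Relation.Nullary using (does; yes; no; ¬_)
  open import Relation.Nullary.Negation using (contradiction)
  open ≤-Reasoning

  *-monoˡ-≤-0≤ : ∀ {i j} k → 0ℤ ≤ k → i ≤ j → k * i ≤ k * j
  *-monoˡ-≤-0≤ k 0≤k = *-monoˡ-≤-nonNeg k {{nonNegative 0≤k}}

  *-monoʳ-≤-0≤ : ∀ {i j} k → 0ℤ ≤ k → i ≤ j → i * k ≤ j * k
  *-monoʳ-≤-0≤ k 0≤k = *-monoʳ-≤-nonNeg k {{nonNegative 0≤k}}

  *-cancelˡ-≤-0< : ∀ {i j} k → 0ℤ < k → k * i ≤ k * j → i ≤ j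
  *-cancelˡ-≤-0< {i} {j} k 0<k = *-cancelˡ-≤-pos i j k {{positive 0<k}}

  0≤i*j : ∀ {i j} → 0ℤ ≤ i → 0ℤ ≤ j → 0ℤ ≤ i * j
  0≤i*j {i} {j} 0≤i 0≤j = ≤-trans (≤-reflexive (sym (*-zeroʳ i))) (*-monoˡ-≤-0≤ i 0≤i 0≤j)

  0<i*j : ∀ {i j} → 0ℤ < i → 0ℤ < j → 0ℤ < i * j
  0<i*j {i} {j} 0<i 0<j = *-monoʳ-<-pos j {{positive 0<j}} 0<i

  0≤i*i : ∀ i → 0ℤ ≤ i * i
  0≤i*i +0 = +≤+ ℕ.z≤n
  0≤i*i +[1+ n ] = +≤+ ℕ.z≤n
  0≤i*i -[1+ n ] = +≤+ ℕ.z≤n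

  *-self-mono-≤ : ∀ {i j} → 0ℤ ≤ i → i ≤ j → i * i ≤ j * j
  *-self-mono-≤ {i} {j} 0≤i i≤j =
    ≤-trans (*-monoˡ-≤-0≤ i 0≤i i≤j) (*-monoʳ-≤-0≤ j (≤-trans 0≤i i≤j) i≤j)

  i≤i*j : ∀ {i j} → 0ℤ ≤ i → 1ℤ ≤ j → i ≤ i * j
  i≤i*j {i} 0≤i 1≤j = ≤-trans (≤-reflexive (sym (*-identityʳ i))) (*-monoˡ-≤-0≤ i 0≤i 1≤j)

  pos-∸ : ∀ {m n} → n ℕ.≤ m → + (m ℕ.∸ n) ≡ + m - + n
  pos-∸ {m} {n} n≤m = trans (sym (⊖-≥ n≤m)) (sym (m-n≡m⊖n m n))

  pos-cube : ∀ t → + (t ℕ.^ 3) ≡ + t * + t * + t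
  pos-cube t = begin-equality
    + (t ℕ.* (t ℕ.* (t ℕ.* 1)))   ≡⟨ pos-* t _ ⟩
    + t * + (t ℕ.* (t ℕ.* 1))     ≡⟨ cong (+ t *_) (pos-* t _) ⟩
    + t * (+ t * + (t ℕ.* 1))     ≡⟨ cong (λ x → + t * (+ t * + x)) (ℕₚ.*-identityʳ t) ⟩
    + t * (+ t * + t)             ≡⟨ *-assoc (+ t) (+ t) (+ t) ⟨
    + t * + t * + t               ∎

  i*i≤i*j⇒i≤j : ∀ {i j} → 0ℤ ≤ i → 0ℤ ≤ j → i * i ≤ i * j → i ≤ j
  i*i≤i*j⇒i≤j {+0} _ 0≤j _ = 0≤j
  i*i≤i*j⇒i≤j {+[1+ n ]} _ _ h = *-cancelˡ-≤-0< +[1+ n ] (+<+ (ℕ.s≤s ℕ.z≤n)) h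

  -- For x ≤ n², the bound is immediate; otherwise n²(x - n²) ≤ x(x - n²) ≤ n w.
  x*x≤n*[n*x+w]⇒n*x≤n*[n*n]+w : ∀ {n x w} → 0ℤ < n → 0ℤ ≤ w →
    x * x ≤ n * (n * x + w) → n * x ≤ n * (n * n) + w
  x*x≤n*[n*x+w]⇒n*x≤n*[n*n]+w {n} {x} {w} 0<n 0≤w h with ≤-total x (n * n)
  ... | inj₁ x≤n² = ≤-trans (*-monoˡ-≤-0≤ n (<⇒≤ 0<n) x≤n²) (i≤i+j (n * (n * n)) w {{nonNegative 0≤w}})
  ... | inj₂ n²≤x = 0≤i-j⇒j≤i (≤-trans (i≤j⇒0≤j-i excess≤w) (≤-reflexive (e₄ n x w)))
    where
    0≤excess : 0ℤ ≤ x - n * n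
    0≤excess = i≤j⇒0≤j-i n²≤x
    excess≤w : n * (x - n * n) ≤ w
    excess≤w = *-cancelˡ-≤-0< n 0<n (begin
      n * (n * (x - n * n))         ≡⟨ e₁ n x ⟩
      n * n * (x - n * n)           ≤⟨ *-monoʳ-≤-0≤ (x - n * n) 0≤excess n²≤x ⟩
      x * (x - n * n)               ≡⟨ e₂ n x ⟩
      x * x - n * n * x             ≤⟨ +-monoˡ-≤ (- (n * n * x)) h ⟩
      n * (n * x + w) - n * n * x   ≡⟨ e₃ n x w ⟩
      n * w                         ∎)
      where
      e₁ : ∀ n x → n * (n * (x - n * n)) ≡ n * n * (x - n * n)
      e₁ = solve-∀
      e₂ : ∀ n x → x * (x - n * n) ≡ x * x - n * n * x
      e₂ = solve-∀
      e₃ : ∀ n x w → n * (n * x + w) - n * n * x ≡ n * w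
      e₃ = solve-∀
    e₄ : ∀ n x w → w - n * (x - n * n) ≡ n * (n * n) + w - n * x
    e₄ = solve-∀

  _⁺ : ℤ → ℤ
  (+ n) ⁺ = + n
  -[1+ n ] ⁺ = 0ℤ

  0≤i⁺ : ∀ i → 0ℤ ≤ i ⁺
  0≤i⁺ (+ n) = +≤+ ℕ.z≤n
  0≤i⁺ -[1+ n ] = +≤+ ℕ.z≤n

  i⁺-lub : ∀ {i j} → i ≤ j → 0ℤ ≤ j → i ⁺ ≤ j
  i⁺-lub {+ n} i≤j _ = i≤j
  i⁺-lub { -[1+ n ]} _ 0≤j = 0≤j

  i⁺*i≡i⁺*i⁺ : ∀ i → i ⁺ * i ≡ i ⁺ * i ⁺
  i⁺*i≡i⁺*i⁺ (+ n) = refl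
  i⁺*i≡i⁺*i⁺ -[1+ n ] = refl

  [-i]⁺*i≡-[-i]⁺² : ∀ i → (- i) ⁺ * i ≡ - ((- i) ⁺ * (- i) ⁺)
  [-i]⁺*i≡-[-i]⁺² +0 = refl
  [-i]⁺*i≡-[-i]⁺² +[1+ n ] = refl
  [-i]⁺*i≡-[-i]⁺² -[1+ n ] = refl

  [-i]⁺≡i⁺-i : ∀ i → (- i) ⁺ ≡ i ⁺ - i
  [-i]⁺≡i⁺-i +0 = refl
  [-i]⁺≡i⁺-i +[1+ n ] = sym (+-inverseʳ +[1+ n ])
  [-i]⁺≡i⁺-i -[1+ n ] = refl

  i*i≡i⁺²+[-i]⁺² : ∀ i → i * i ≡ i ⁺ * i ⁺ + (- i) ⁺ * (- i) ⁺
  i*i≡i⁺²+[-i]⁺² +0 = refl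
  i*i≡i⁺²+[-i]⁺² +[1+ n ] = sym (+-identityʳ _)
  i*i≡i⁺²+[-i]⁺² -[1+ n ] = sym (+-identityˡ _)

  δ : ∀ {n} → Fin n → Fin n → ℤ
  δ i j = if does (i ≟ j) then 1ℤ else 0ℤ

  δ-refl : ∀ {n} (i : Fin n) → δ i i ≡ 1ℤ
  δ-refl zero = refl
  δ-refl (suc i) = δ-refl i

  δ-comm : ∀ {n} (i j : Fin n) → δ i j ≡ δ j i
  δ-comm zero zero = refl
  δ-comm zero (suc j) = refl
  δ-comm (suc i) zero = refl
  δ-comm (suc i) (suc j) = δ-comm i j

  δ*δ≡δ : ∀ {n} (i j : Fin n) → δ i j * δ i j ≡ δ i j
  δ*δ≡δ i j with does (i ≟ j)
  ... | true = refl
  ... | false = refl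

  0≤δ : ∀ {n} (i j : Fin n) → 0ℤ ≤ δ i j
  0≤δ i j with does (i ≟ j)
  ... | true = +≤+ ℕ.z≤n
  ... | false = +≤+ ℕ.z≤n

  ∑-mono-≤ : ∀ {n} {f g : Fin n → ℤ} → (∀ i → f i ≤ g i) → sum f ≤ sum g
  ∑-mono-≤ {zero} _ = ≤-refl
  ∑-mono-≤ {suc n} f≤g = +-mono-≤ (f≤g zero) (∑-mono-≤ (λ i → f≤g (suc i)))

  ∑-const : ∀ n c → ∑[ i < n ] c ≡ + n * c
  ∑-const zero c = refl
  ∑-const (suc n) c = trans (cong (_+_ c) (∑-const n c)) (e c (+ n))
    where
    e : ∀ c m → c + m * c ≡ (1ℤ + m) * c
    e = solve-∀

  ∑-δ : ∀ {n} (i : Fin n) (f : Fin n → ℤ) → ∑[ j < n ] (δ i j * f j) ≡ f i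
  ∑-δ {suc n} zero f = begin-equality
    1ℤ * f zero + ∑[ j < n ] 0ℤ ≡⟨ cong₂ _+_ (*-identityˡ (f zero)) (∑-const n 0ℤ) ⟩
    f zero + + n * 0ℤ           ≡⟨ cong (_+_ (f zero)) (*-zeroʳ (+ n)) ⟩
    f zero + 0ℤ                 ≡⟨ +-identityʳ (f zero) ⟩
    f zero                      ∎
  ∑-δ {suc n} (suc i) f = trans (+-identityˡ _) (∑-δ i (λ j → f (suc j)))

  -- Finite sums, abstracted so that Cauchy-Schwarz is proved once for sums over Fin n,
  -- over coordinates Fin r × Fin q and over pairs of coordinates.
  record Integral (I : Set) : Set where
    field
      ∫        : (I → ℤ) → ℤ
      ∫-cong   : ∀ {f g} → f ≗ g → ∫ f ≡ ∫ g
      ∫-+      : ∀ f g → ∫ (λ x → f x + g x) ≡ ∫ f + ∫ g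
      ∫-*ˡ     : ∀ c f → ∫ (λ x → c * f x) ≡ c * ∫ f
      ∫-mono-≤ : ∀ {f g} → (∀ x → f x ≤ g x) → ∫ f ≤ ∫ g

  counting : ∀ n → Integral (Fin n)
  counting n = record
    { ∫        = sum
    ; ∫-cong   = sum-cong-≗
    ; ∫-+      = ∑-distrib-+
    ; ∫-*ˡ     = λ c f → sym (*-distribˡ-sum c f)
    ; ∫-mono-≤ = ∑-mono-≤
    }

  _⊗_ : ∀ {I J} → Integral I → Integral J → Integral (I × J)
  μ ⊗ ν = record
    { ∫        = λ h → μ.∫ (λ x → ν.∫ (λ y → h (x , y)))
    ; ∫-cong   = λ f≗g → μ.∫-cong (λ x → ν.∫-cong (λ y → f≗g (x , y)))
    ; ∫-+      = λ f g → trans (μ.∫-cong (λ x → ν.∫-+ _ _)) (μ.∫-+ _ _)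
    ; ∫-*ˡ     = λ c f → trans (μ.∫-cong (λ x → ν.∫-*ˡ c _)) (μ.∫-*ˡ c _)
    ; ∫-mono-≤ = λ f≤g → μ.∫-mono-≤ (λ x → ν.∫-mono-≤ (λ y → f≤g (x , y)))
    }
    where
    module μ = Integral μ
    module ν = Integral ν

  module IntegralProperties {I : Set} (μ : Integral I) where

    open Integral μ public

    ∫-zero : ∫ (λ _ → 0ℤ) ≡ 0ℤ
    ∫-zero = ∫-*ˡ 0ℤ (λ _ → 0ℤ)

    ∫-*ʳ : ∀ c f → ∫ (λ x → f x * c) ≡ ∫ f * c
    ∫-*ʳ c f = trans (∫-cong (λ x → *-comm (f x) c)) (trans (∫-*ˡ c f) (*-comm c (∫ f)))

    ∫-neg : ∀ f → ∫ (λ x → - f x) ≡ - ∫ f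
    ∫-neg f = trans (∫-cong (λ x → sym (-1*i≡-i (f x)))) (trans (∫-*ˡ (- 1ℤ) f) (-1*i≡-i (∫ f)))

    ∫-nonNeg : ∀ {f} → (∀ x → 0ℤ ≤ f x) → 0ℤ ≤ ∫ f
    ∫-nonNeg 0≤f = ≤-trans (≤-reflexive (sym ∫-zero)) (∫-mono-≤ 0≤f)

    ∫-linear₂ : ∀ a b (f g : I → ℤ) → ∫ (λ x → a * f x + b * g x) ≡ a * ∫ f + b * ∫ g
    ∫-linear₂ a b f g = trans (∫-+ _ _) (cong₂ _+_ (∫-*ˡ a f) (∫-*ˡ b g))

    ∫-linear₃ : ∀ a b c (f g h : I → ℤ) →
      ∫ (λ x → a * f x + b * g x + c * h x) ≡ a * ∫ f + b * ∫ g + c * ∫ h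
    ∫-linear₃ a b c f g h = trans (∫-+ _ _) (cong₂ _+_ (∫-linear₂ a b f g) (∫-*ˡ c h))

    ∫-∑-comm : ∀ n (h : I → Fin n → ℤ) → ∫ (λ x → ∑[ j < n ] h x j) ≡ ∑[ j < n ] ∫ (λ x → h x j)
    ∫-∑-comm zero h = ∫-zero
    ∫-∑-comm (suc n) h = trans (∫-+ _ _) (cong (_+_ (∫ (λ x → h x zero))) (∫-∑-comm n (λ x j → h x (suc j))))

    -- Lagrange's identity: 2 (∫f² ∫g² - (∫fg)²) = ∫∫ (f x g y - f y g x)².
    cauchy-schwarz : ∀ (f g : I → ℤ) →
      ∫ (λ x → f x * g x) * ∫ (λ x → f x * g x) ≤ ∫ (λ x → f x * f x) * ∫ (λ x → g x * g x)
    cauchy-schwarz f g = 0≤i-j⇒j≤i (*-cancelˡ-≤-0< (+ 2) (+<+ (ℕ.s≤s ℕ.z≤n)) (begin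
      + 2 * 0ℤ                                           ≡⟨ *-zeroʳ (+ 2) ⟩
      0ℤ                                                 ≤⟨ ∫-nonNeg (λ x → ∫-nonNeg (λ y → 0≤i*i (d x y))) ⟩
      ∫ (λ x → ∫ (λ y → d x y * d x y))                  ≡⟨ ∫-cong inner ⟩
      ∫ (λ x → G * (f x * f x) + F * (g x * g x) + (- (+ 2) * P) * (f x * g x))
                                                         ≡⟨ ∫-linear₃ G F (- (+ 2) * P) f² g² fg ⟩
      G * F + F * G + (- (+ 2) * P) * P                  ≡⟨ e₂ F G P ⟩
      + 2 * (F * G - P * P)                              ∎))
      where
      f² g² fg : I → ℤ
      f² x = f x * f x
      g² x = g x * g x
      fg x = f x * g x
      F G P : ℤ
      F = ∫ f²
      G = ∫ g²
      P = ∫ fg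
      d : I → I → ℤ
      d x y = f x * g y - f y * g x
      e₁ : ∀ a b c d → (a * d - c * b) * (a * d - c * b) ≡ (a * a) * (d * d) + (b * b) * (c * c) + (- (+ 2) * (a * b)) * (c * d)
      e₁ = solve-∀
      e₂ : ∀ F G P → G * F + F * G + (- (+ 2) * P) * P ≡ + 2 * (F * G - P * P)
      e₂ = solve-∀
      e₃ : ∀ a b c G F P → a * G + b * F + (- (+ 2) * c) * P ≡ G * a + F * b + (- (+ 2) * P) * c
      e₃ = solve-∀
      inner : ∀ x → ∫ (λ y → d x y * d x y) ≡ G * (f x * f x) + F * (g x * g x) + (- (+ 2) * P) * (f x * g x)
      inner x = trans (∫-cong (λ y → e₁ (f x) (g x) (f y) (g y)))
        (trans (∫-linear₃ (f x * f x) (g x * g x) (- (+ 2) * (f x * g x)) g² f² fg)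
          (e₃ (f x * f x) (g x * g x) (f x * g x) G F P))

  module FinSum {n} = IntegralProperties (counting n)

  [∑b]²≤n*∑b² : ∀ {n} (b : Fin n → ℤ) → sum b * sum b ≤ + n * ∑[ i < n ] (b i * b i)
  [∑b]²≤n*∑b² {n} b = begin
    sum b * sum b                                     ≡⟨ cong (λ x → x * x) (sum-cong-≗ (λ i → sym (*-identityˡ (b i)))) ⟩
    ∑[ i < n ] (1ℤ * b i) * ∑[ i < n ] (1ℤ * b i)     ≤⟨ FinSum.cauchy-schwarz (λ _ → 1ℤ) b ⟩
    ∑[ i < n ] 1ℤ * ∑[ i < n ] (b i * b i)            ≡⟨ cong (_* ∑[ i < n ] (b i * b i)) (trans (∑-const n 1ℤ) (*-identityʳ (+ n))) ⟩
    + n * ∑[ i < n ] (b i * b i)                      ∎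

  ∑*∑≡∑∑ : ∀ {m n} (a : Fin m → ℤ) (b : Fin n → ℤ) → sum a * sum b ≡ ∑[ i < m ] ∑[ j < n ] (a i * b j)
  ∑*∑≡∑∑ a b = trans (*-distribʳ-sum (sum b) a) (sum-cong-≗ (λ i → *-distribˡ-sum (a i) b))

  -- Gram matrices with constant diagonal and bounded off-diagonal entries

  frobenius-majorant : ℤ → ℤ → ℤ → ℤ
  frobenius-majorant m N A =
    N * (m * (A * A) + (+ 2 * A + N) * N) + N * (N * N) + A * ((m * A + N) * (m * A + N))

  frobenius-majorant-homogeneous : ∀ m c N A →
    frobenius-majorant m (c * N) (c * A) ≡ c * c * c * frobenius-majorant m N A
  frobenius-majorant-homogeneous = e
    where
    -- Unfolded by hand: the ring solver does not unfold frobenius-majorant.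
    e : ∀ m c N A →
      c * N * (m * (c * A * (c * A)) + (+ 2 * (c * A) + c * N) * (c * N)) + c * N * (c * N * (c * N))
        + c * A * ((m * (c * A) + c * N) * (m * (c * A) + c * N))
      ≡ c * c * c * (N * (m * (A * A) + (+ 2 * A + N) * N) + N * (N * N) + A * ((m * A + N) * (m * A + N)))
    e = solve-∀

  frobenius-majorant-mono : ∀ {m m′ N A} → 0ℤ ≤ N → 0ℤ ≤ A → 0ℤ ≤ m → m ≤ m′ →
    frobenius-majorant m N A ≤ frobenius-majorant m′ N A
  frobenius-majorant-mono {m} {m′} {N} {A} 0≤N 0≤A 0≤m m≤m′ = +-mono-≤
    (+-monoˡ-≤ (N * (N * N)) (*-monoˡ-≤-0≤ N 0≤N (+-monoˡ-≤ ((+ 2 * A + N) * N) (*-monoʳ-≤-0≤ (A * A) (0≤i*i A) m≤m′))))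
    (*-monoˡ-≤-0≤ A 0≤A (*-self-mono-≤ 0≤mA+N (+-monoˡ-≤ N (*-monoʳ-≤-0≤ A 0≤A m≤m′))))
    where
    0≤mA+N : 0ℤ ≤ m * A + N
    0≤mA+N = +-mono-≤ (0≤i*j 0≤m 0≤A) 0≤N

  module GramSystem {D : Set} (μ : Integral D) {M : ℕ} (v : Fin M → D → ℤ) where

    open IntegralProperties μ

    ⟨_,_⟩ : (D → ℤ) → (D → ℤ) → ℤ
    ⟨ f , g ⟩ = ∫ (λ k → f k * g k)

    gram : Fin M → Fin M → ℤ
    gram i j = ⟨ v i , v j ⟩

    combination : (Fin M → ℤ) → D → ℤ
    combination c k = ∑[ j < M ] (c j * v j k)

    ⟨⟩-comm : ∀ f g → ⟨ f , g ⟩ ≡ ⟨ g , f ⟩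
    ⟨⟩-comm f g = ∫-cong (λ k → *-comm (f k) (g k))

    0≤⟨f,f⟩ : ∀ f → 0ℤ ≤ ⟨ f , f ⟩
    0≤⟨f,f⟩ f = ∫-nonNeg (λ k → 0≤i*i (f k))

    ⟨f,-g⟩≡-⟨f,g⟩ : ∀ f g → ⟨ f , (λ k → - g k) ⟩ ≡ - ⟨ f , g ⟩
    ⟨f,-g⟩≡-⟨f,g⟩ f g = trans (∫-cong (λ k → sym (neg-distribʳ-* (f k) (g k)))) (∫-neg _)

    ⟨-f,-f⟩≡⟨f,f⟩ : ∀ f → ⟨ (λ k → - f k) , (λ k → - f k) ⟩ ≡ ⟨ f , f ⟩
    ⟨-f,-f⟩≡⟨f,f⟩ f = ∫-cong (λ k → e (f k))
      where
      e : ∀ x → (- x) * (- x) ≡ x * x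
      e = solve-∀

    ⟨combination,g⟩≡∑ : ∀ c g → ⟨ combination c , g ⟩ ≡ ∑[ j < M ] (c j * ⟨ v j , g ⟩)
    ⟨combination,g⟩≡∑ c g = begin-equality
      ∫ (λ k → combination c k * g k)                ≡⟨ ∫-cong (λ k → *-distribʳ-sum (g k) (λ j → c j * v j k)) ⟩
      ∫ (λ k → ∑[ j < M ] (c j * v j k * g k))       ≡⟨ ∫-∑-comm M (λ k j → c j * v j k * g k) ⟩
      ∑[ j < M ] ∫ (λ k → c j * v j k * g k)         ≡⟨ sum-cong-≗ (λ j → trans (∫-cong (λ k → *-assoc (c j) (v j k) (g k))) (∫-*ˡ (c j) _)) ⟩
      ∑[ j < M ] (c j * ⟨ v j , g ⟩)                 ∎

    private
      module μ² = IntegralProperties (μ ⊗ μ)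

    outer : D × D → ℤ
    outer (k , l) = ∑[ i < M ] (v i k * v i l)

    ∫outer²≡∑gram² : μ².∫ (λ kl → outer kl * outer kl) ≡ ∑[ i < M ] ∑[ j < M ] (gram i j * gram i j)
    ∫outer²≡∑gram² = begin-equality
      μ².∫ (λ kl → outer kl * outer kl)                         ≡⟨ μ².∫-cong (λ kl → outer² (proj₁ kl) (proj₂ kl)) ⟩
      μ².∫ (λ kl → ∑[ i < M ] ∑[ j < M ] (w i j (proj₁ kl) * w i j (proj₂ kl)))
                                                                 ≡⟨ μ².∫-∑-comm M (λ kl i → ∑[ j < M ] (w i j (proj₁ kl) * w i j (proj₂ kl))) ⟩
      ∑[ i < M ] μ².∫ (λ kl → ∑[ j < M ] (w i j (proj₁ kl) * w i j (proj₂ kl)))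
                                                                 ≡⟨ sum-cong-≗ (λ i → μ².∫-∑-comm M (λ kl j → w i j (proj₁ kl) * w i j (proj₂ kl))) ⟩
      ∑[ i < M ] ∑[ j < M ] μ².∫ (λ kl → w i j (proj₁ kl) * w i j (proj₂ kl))
                                                                 ≡⟨ sum-cong-≗ (λ i → sum-cong-≗ (λ j → separable (w i j) (w i j))) ⟩
      ∑[ i < M ] ∑[ j < M ] (gram i j * gram i j)               ∎
      where
      w : Fin M → Fin M → D → ℤ
      w i j k = v i k * v j k
      e : ∀ a b c d → a * b * (c * d) ≡ a * c * (b * d)
      e = solve-∀
      outer² : ∀ k l → outer (k , l) * outer (k , l) ≡ ∑[ i < M ] ∑[ j < M ] (w i j k * w i j l)
      outer² k l = trans (∑*∑≡∑∑ (λ i → v i k * v i l) (λ j → v j k * v j l))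
        (sum-cong-≗ (λ i → sum-cong-≗ (λ j → e (v i k) (v i l) (v j k) (v j l))))
      separable : ∀ f g → μ².∫ (λ kl → f (proj₁ kl) * g (proj₂ kl)) ≡ ∫ f * ∫ g
      separable f g = trans (∫-cong (λ k → ∫-*ˡ (f k) g)) (∫-*ʳ (∫ g) f)

    module _ {N A : ℤ} (0<N : 0ℤ < N) (0≤A : 0ℤ ≤ A)
             (gram-diag : ∀ i → gram i i ≡ N) (gram-off : ∀ {i j} → ¬ i ≡ j → gram i j ≤ A) where

      majorant : Fin M → Fin M → ℤ
      majorant i j = A + δ i j * N

      K : ℤ
      K = + M * A + N

      0≤K : 0ℤ ≤ K
      0≤K = +-mono-≤ (0≤i*j {+ M} (+≤+ ℕ.z≤n) 0≤A) (<⇒≤ 0<N)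

      gram≤majorant : ∀ i j → gram i j ≤ majorant i j
      gram≤majorant i j with i ≟ j
      ... | yes refl = begin
        gram i i   ≡⟨ gram-diag i ⟩
        N          ≤⟨ i≤j+i N A {{nonNegative 0≤A}} ⟩
        A + N      ≡⟨ cong (_+_ A) (sym (*-identityˡ N)) ⟩
        A + 1ℤ * N ∎
      ... | no i≢j = ≤-trans (gram-off i≢j) (≤-reflexive (sym (+-identityʳ A)))

      0≤majorant : ∀ i j → 0ℤ ≤ majorant i j
      0≤majorant i j = +-mono-≤ 0≤A (0≤i*j (0≤δ i j) (<⇒≤ 0<N))

      ∑-majorant : ∀ i → ∑[ j < M ] majorant i j ≡ K
      ∑-majorant i = trans (FinSum.∫-+ (λ _ → A) (λ j → δ i j * N))
        (cong₂ _+_ (∑-const M A) (∑-δ i (λ _ → N)))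

      ∑-weighted-majorant : ∀ c j → ∑[ k < M ] (c k * majorant k j) ≡ A * sum c + N * c j
      ∑-weighted-majorant c j = begin-equality
        ∑[ k < M ] (c k * majorant k j)                ≡⟨ sum-cong-≗ (λ k → trans (e A N (c k) (δ k j)) (cong (λ d → A * c k + d * (N * c k)) (δ-comm k j))) ⟩
        ∑[ k < M ] (A * c k + δ j k * (N * c k))       ≡⟨ FinSum.∫-+ (λ k → A * c k) (λ k → δ j k * (N * c k)) ⟩
        ∑[ k < M ] (A * c k) + ∑[ k < M ] (δ j k * (N * c k))  ≡⟨ cong₂ _+_ (FinSum.∫-*ˡ A c) (∑-δ j (λ k → N * c k)) ⟩
        A * sum c + N * c j                            ∎
        where
        e : ∀ A N c d → c * (A + d * N) ≡ A * c + d * (N * c)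
        e = solve-∀

      ⟨combination,combination⟩≤ : ∀ c → (∀ j → 0ℤ ≤ c j) →
        ⟨ combination c , combination c ⟩ ≤ N * ∑[ j < M ] (c j * c j) + A * (sum c * sum c)
      ⟨combination,combination⟩≤ c 0≤c = begin
        ⟨ z , z ⟩                                ≡⟨ ⟨combination,g⟩≡∑ c z ⟩
        ∑[ j < M ] (c j * ⟨ v j , z ⟩)           ≤⟨ ∑-mono-≤ (λ j → *-monoˡ-≤-0≤ (c j) (0≤c j) (⟨vⱼ,z⟩≤ j)) ⟩
        ∑[ j < M ] (c j * (A * sum c + N * c j)) ≡⟨ sum-cong-≗ (λ j → e N (c j) (A * sum c)) ⟩
        ∑[ j < M ] ((A * sum c) * c j + N * (c j * c j)) ≡⟨ FinSum.∫-linear₂ (A * sum c) N c (λ j → c j * c j) ⟩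
        (A * sum c) * sum c + N * ∑[ j < M ] (c j * c j) ≡⟨ e′ A N (sum c) _ ⟩
        N * ∑[ j < M ] (c j * c j) + A * (sum c * sum c) ∎
        where
        z : D → ℤ
        z = combination c
        e : ∀ N c a → c * (a + N * c) ≡ a * c + N * (c * c)
        e = solve-∀
        e′ : ∀ A N s x → A * s * s + N * x ≡ N * x + A * (s * s)
        e′ = solve-∀
        ⟨vⱼ,z⟩≤ : ∀ j → ⟨ v j , z ⟩ ≤ A * sum c + N * c j
        ⟨vⱼ,z⟩≤ j = begin
          ⟨ v j , z ⟩                      ≡⟨ ⟨⟩-comm (v j) z ⟩
          ⟨ z , v j ⟩                      ≡⟨ ⟨combination,g⟩≡∑ c (v j) ⟩
          ∑[ k < M ] (c k * gram k j)      ≤⟨ ∑-mono-≤ (λ k → *-monoˡ-≤-0≤ (c k) (0≤c k) (gram≤majorant k j)) ⟩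
          ∑[ k < M ] (c k * majorant k j)  ≡⟨ ∑-weighted-majorant c j ⟩
          A * sum c + N * c j              ∎

      bessel : ∀ u → ∑[ i < M ] (⟨ v i , u ⟩ ⁺ * ⟨ v i , u ⟩ ⁺) ≤ K * ⟨ u , u ⟩
      bessel u = i*i≤i*j⇒i≤j 0≤B (0≤i*j 0≤K (0≤⟨f,f⟩ u)) (begin
        B * B                    ≡⟨ cong (λ x → x * x) (sym ⟨z,u⟩≡B) ⟩
        ⟨ z , u ⟩ * ⟨ z , u ⟩    ≤⟨ cauchy-schwarz z u ⟩
        ⟨ z , z ⟩ * ⟨ u , u ⟩    ≤⟨ *-monoʳ-≤-0≤ ⟨ u , u ⟩ (0≤⟨f,f⟩ u) ⟨z,z⟩≤K*B ⟩
        K * B * ⟨ u , u ⟩        ≡⟨ e K B ⟨ u , u ⟩ ⟩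
        B * (K * ⟨ u , u ⟩)      ∎)
        where
        b : Fin M → ℤ
        b i = ⟨ v i , u ⟩ ⁺
        B : ℤ
        B = ∑[ i < M ] (b i * b i)
        z : D → ℤ
        z = combination b
        0≤B : 0ℤ ≤ B
        0≤B = FinSum.∫-nonNeg (λ i → 0≤i*i (b i))
        ⟨z,u⟩≡B : ⟨ z , u ⟩ ≡ B
        ⟨z,u⟩≡B = trans (⟨combination,g⟩≡∑ b u) (sum-cong-≗ (λ i → i⁺*i≡i⁺*i⁺ ⟨ v i , u ⟩))
        ⟨z,z⟩≤K*B : ⟨ z , z ⟩ ≤ K * B
        ⟨z,z⟩≤K*B = begin
          ⟨ z , z ⟩                       ≤⟨ ⟨combination,combination⟩≤ b (λ i → 0≤i⁺ ⟨ v i , u ⟩) ⟩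
          N * B + A * (sum b * sum b)     ≤⟨ +-monoʳ-≤ (N * B) (*-monoˡ-≤-0≤ A 0≤A ([∑b]²≤n*∑b² b)) ⟩
          N * B + A * (+ M * B)           ≡⟨ e′ N A (+ M) B ⟩
          K * B                           ∎
          where
          e′ : ∀ N A m B → N * B + A * (m * B) ≡ (m * A + N) * B
          e′ = solve-∀
        e : ∀ K B x → K * B * x ≡ B * (K * x)
        e = solve-∀

      row-sum : Fin M → ℤ
      row-sum i = ∑[ j < M ] gram i j

      deficit : Fin M → ℤ
      deficit i = K - row-sum i

      ∑row-sum²≤ : ∑[ i < M ] (row-sum i * row-sum i) ≤ K * ∑[ i < M ] row-sum i + K * ∑[ i < M ] row-sum i
      ∑row-sum²≤ = begin
        ∑[ i < M ] (row-sum i * row-sum i)                    ≡⟨ sum-cong-≗ (λ i → trans (cong (λ x → x * x) (sym (⟨vᵢ,w⟩≡row-sum i))) (i*i≡i⁺²+[-i]⁺² ⟨ v i , w ⟩)) ⟩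
        ∑[ i < M ] (⟨ v i , w ⟩ ⁺ * ⟨ v i , w ⟩ ⁺ + (- ⟨ v i , w ⟩) ⁺ * (- ⟨ v i , w ⟩) ⁺)
                                                              ≡⟨ FinSum.∫-+ (λ i → ⟨ v i , w ⟩ ⁺ * ⟨ v i , w ⟩ ⁺) (λ i → (- ⟨ v i , w ⟩) ⁺ * (- ⟨ v i , w ⟩) ⁺) ⟩
        ∑[ i < M ] (⟨ v i , w ⟩ ⁺ * ⟨ v i , w ⟩ ⁺) + ∑[ i < M ] ((- ⟨ v i , w ⟩) ⁺ * (- ⟨ v i , w ⟩) ⁺)
                                                              ≡⟨ cong (_+_ (∑[ i < M ] (⟨ v i , w ⟩ ⁺ * ⟨ v i , w ⟩ ⁺))) (sum-cong-≗ (λ i → cong (λ x → x ⁺ * x ⁺) (sym (⟨f,-g⟩≡-⟨f,g⟩ (v i) w)))) ⟩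
        ∑[ i < M ] (⟨ v i , w ⟩ ⁺ * ⟨ v i , w ⟩ ⁺) + ∑[ i < M ] (⟨ v i , -w ⟩ ⁺ * ⟨ v i , -w ⟩ ⁺)
                                                              ≤⟨ +-mono-≤ (bessel w) (bessel -w) ⟩
        K * ⟨ w , w ⟩ + K * ⟨ -w , -w ⟩                       ≡⟨ cong₂ (λ x y → K * x + K * y) ⟨w,w⟩≡∑row-sum (trans (⟨-f,-f⟩≡⟨f,f⟩ w) ⟨w,w⟩≡∑row-sum) ⟩
        K * ∑[ i < M ] row-sum i + K * ∑[ i < M ] row-sum i   ∎
        where
        w -w : D → ℤ
        w = combination (λ _ → 1ℤ)
        -w k = - w k
        ⟨vᵢ,w⟩≡row-sum : ∀ i → ⟨ v i , w ⟩ ≡ row-sum i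
        ⟨vᵢ,w⟩≡row-sum i = trans (⟨⟩-comm (v i) w) (trans (⟨combination,g⟩≡∑ (λ _ → 1ℤ) (v i))
          (sum-cong-≗ (λ j → trans (*-identityˡ _) (⟨⟩-comm (v j) (v i)))))
        ⟨w,w⟩≡∑row-sum : ⟨ w , w ⟩ ≡ ∑[ i < M ] row-sum i
        ⟨w,w⟩≡∑row-sum = trans (⟨combination,g⟩≡∑ (λ _ → 1ℤ) w) (sum-cong-≗ (λ j → trans (*-identityˡ _) (⟨vᵢ,w⟩≡row-sum j)))

      ∑deficit²≤ : ∑[ i < M ] (deficit i * deficit i) ≤ + M * (K * K)
      ∑deficit²≤ = begin
        ∑[ i < M ] (deficit i * deficit i)                  ≡⟨ sum-cong-≗ (λ i → e K (row-sum i)) ⟩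
        ∑[ i < M ] ((K * K) * 1ℤ + (- (+ 2) * K) * row-sum i + 1ℤ * (row-sum i * row-sum i))
                                                            ≡⟨ FinSum.∫-linear₃ (K * K) (- (+ 2) * K) 1ℤ (λ _ → 1ℤ) row-sum (λ i → row-sum i * row-sum i) ⟩
        (K * K) * ∑[ i < M ] 1ℤ + (- (+ 2) * K) * Y + 1ℤ * ∑[ i < M ] (row-sum i * row-sum i)
                                                            ≤⟨ +-monoʳ-≤ ((K * K) * ∑[ i < M ] 1ℤ + (- (+ 2) * K) * Y) (*-monoˡ-≤-0≤ 1ℤ (+≤+ ℕ.z≤n) ∑row-sum²≤) ⟩
        (K * K) * ∑[ i < M ] 1ℤ + (- (+ 2) * K) * Y + 1ℤ * (K * Y + K * Y)
                                                            ≡⟨ cong (λ x → (K * K) * x + (- (+ 2) * K) * Y + 1ℤ * (K * Y + K * Y)) (∑-const M 1ℤ) ⟩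
        (K * K) * (+ M * 1ℤ) + (- (+ 2) * K) * Y + 1ℤ * (K * Y + K * Y)
                                                            ≡⟨ e′ K Y (+ M) ⟩
        + M * (K * K)                                       ∎
        where
        Y : ℤ
        Y = ∑[ i < M ] row-sum i
        e : ∀ K y → (K - y) * (K - y) ≡ (K * K) * 1ℤ + (- (+ 2) * K) * y + 1ℤ * (y * y)
        e = solve-∀
        e′ : ∀ K Y m → (K * K) * (m * 1ℤ) + (- (+ 2) * K) * Y + 1ℤ * (K * Y + K * Y) ≡ m * (K * K)
        e′ = solve-∀

      0≤∑[-gram]⁺≤deficit : ∀ i → 0ℤ ≤ ∑[ j < M ] (- gram i j) ⁺ × ∑[ j < M ] (- gram i j) ⁺ ≤ deficit i
      0≤∑[-gram]⁺≤deficit i = FinSum.∫-nonNeg (λ j → 0≤i⁺ (- gram i j)) , (begin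
        ∑[ j < M ] (- gram i j) ⁺                            ≡⟨ sum-cong-≗ (λ j → [-i]⁺≡i⁺-i (gram i j)) ⟩
        ∑[ j < M ] (gram i j ⁺ - gram i j)                   ≤⟨ ∑-mono-≤ (λ j → +-monoˡ-≤ (- gram i j) (i⁺-lub (gram≤majorant i j) (0≤majorant i j))) ⟩
        ∑[ j < M ] (majorant i j - gram i j)                 ≡⟨ FinSum.∫-+ (majorant i) (λ j → - gram i j) ⟩
        ∑[ j < M ] majorant i j + ∑[ j < M ] (- gram i j)    ≡⟨ cong₂ _+_ (∑-majorant i) (FinSum.∫-neg (gram i)) ⟩
        deficit i                                            ∎)

      N*∑[-gram]⁺²≤ : ∀ i →
        N * ∑[ j < M ] ((- gram i j) ⁺ * (- gram i j) ⁺) ≤ N * (N * N) + A * (deficit i * deficit i)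
      N*∑[-gram]⁺²≤ i = begin
        N * X                          ≤⟨ x*x≤n*[n*x+w]⇒n*x≤n*[n*n]+w 0<N (0≤i*j 0≤A (0≤i*i (sum c))) X*X≤ ⟩
        N * (N * N) + A * (sum c * sum c)  ≤⟨ +-monoʳ-≤ (N * (N * N)) (*-monoˡ-≤-0≤ A 0≤A (*-self-mono-≤ 0≤∑c ∑c≤deficit)) ⟩
        N * (N * N) + A * (deficit i * deficit i) ∎
        where
        c : Fin M → ℤ
        c j = (- gram i j) ⁺
        X : ℤ
        X = ∑[ j < M ] (c j * c j)
        z : D → ℤ
        z = combination c
        0≤∑c : 0ℤ ≤ sum c
        0≤∑c = proj₁ (0≤∑[-gram]⁺≤deficit i)
        ∑c≤deficit : sum c ≤ deficit i
        ∑c≤deficit = proj₂ (0≤∑[-gram]⁺≤deficit i)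
        ⟨z,vᵢ⟩≡-X : ⟨ z , v i ⟩ ≡ - X
        ⟨z,vᵢ⟩≡-X = begin-equality
          ⟨ z , v i ⟩                    ≡⟨ ⟨combination,g⟩≡∑ c (v i) ⟩
          ∑[ j < M ] (c j * gram j i)    ≡⟨ sum-cong-≗ (λ j → trans (cong (c j *_) (⟨⟩-comm (v j) (v i))) ([-i]⁺*i≡-[-i]⁺² (gram i j))) ⟩
          ∑[ j < M ] (- (c j * c j))     ≡⟨ FinSum.∫-neg (λ j → c j * c j) ⟩
          - X                            ∎
        X*X≤ : X * X ≤ N * (N * X + A * (sum c * sum c))
        X*X≤ = begin
          X * X                          ≡⟨ e X ⟩
          (- X) * (- X)                  ≡⟨ cong (λ x → x * x) (sym ⟨z,vᵢ⟩≡-X) ⟩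
          ⟨ z , v i ⟩ * ⟨ z , v i ⟩      ≤⟨ cauchy-schwarz z (v i) ⟩
          ⟨ z , z ⟩ * ⟨ v i , v i ⟩      ≡⟨ cong (⟨ z , z ⟩ *_) (gram-diag i) ⟩
          ⟨ z , z ⟩ * N                  ≤⟨ *-monoʳ-≤-0≤ N (<⇒≤ 0<N) (⟨combination,combination⟩≤ c (λ j → 0≤i⁺ (- gram i j))) ⟩
          (N * X + A * (sum c * sum c)) * N   ≡⟨ *-comm _ N ⟩
          N * (N * X + A * (sum c * sum c))   ∎
          where
          e : ∀ x → x * x ≡ (- x) * (- x)
          e = solve-∀

      ∑gram⁺²≤ : ∀ i → ∑[ j < M ] (gram i j ⁺ * gram i j ⁺) ≤ + M * (A * A) + (+ 2 * A + N) * N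
      ∑gram⁺²≤ i = begin
        ∑[ j < M ] (gram i j ⁺ * gram i j ⁺)    ≤⟨ ∑-mono-≤ (λ j → *-self-mono-≤ (0≤i⁺ (gram i j)) (i⁺-lub (gram≤majorant i j) (0≤majorant i j))) ⟩
        ∑[ j < M ] (majorant i j * majorant i j) ≡⟨ sum-cong-≗ (λ j → majorant² (δ i j) (δ*δ≡δ i j)) ⟩
        ∑[ j < M ] (A * A + δ i j * ((+ 2 * A + N) * N)) ≡⟨ FinSum.∫-+ (λ _ → A * A) (λ j → δ i j * ((+ 2 * A + N) * N)) ⟩
        ∑[ j < M ] (A * A) + ∑[ j < M ] (δ i j * ((+ 2 * A + N) * N)) ≡⟨ cong₂ _+_ (∑-const M (A * A)) (∑-δ i (λ _ → (+ 2 * A + N) * N)) ⟩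
        + M * (A * A) + (+ 2 * A + N) * N       ∎
        where
        e₁ : ∀ A N d → (A + d * N) * (A + d * N) ≡ A * A + (d * (+ 2 * A * N) + (d * d) * (N * N))
        e₁ = solve-∀
        e₂ : ∀ A N d → A * A + (d * (+ 2 * A * N) + d * (N * N)) ≡ A * A + d * ((+ 2 * A + N) * N)
        e₂ = solve-∀
        majorant² : ∀ d → d * d ≡ d → (A + d * N) * (A + d * N) ≡ A * A + d * ((+ 2 * A + N) * N)
        majorant² d d²≡d = trans (e₁ A N d)
          (trans (cong (λ x → A * A + (d * (+ 2 * A * N) + x * (N * N))) d²≡d) (e₂ A N d))

      N*∑gram²≤ : ∀ i → N * ∑[ j < M ] (gram i j * gram i j) ≤
        N * (+ M * (A * A) + (+ 2 * A + N) * N) + N * (N * N) + A * (deficit i * deficit i)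
      N*∑gram²≤ i = begin
        N * ∑[ j < M ] (gram i j * gram i j)          ≡⟨ cong (N *_) (trans (sum-cong-≗ (λ j → i*i≡i⁺²+[-i]⁺² (gram i j))) (FinSum.∫-+ P Q)) ⟩
        N * (sum P + sum Q)                           ≡⟨ *-distribˡ-+ N (sum P) (sum Q) ⟩
        N * sum P + N * sum Q                         ≤⟨ +-mono-≤ (*-monoˡ-≤-0≤ N (<⇒≤ 0<N) (∑gram⁺²≤ i)) (N*∑[-gram]⁺²≤ i) ⟩
        N * (+ M * (A * A) + (+ 2 * A + N) * N) + (N * (N * N) + A * (deficit i * deficit i))
                                                      ≡⟨ +-assoc (N * (+ M * (A * A) + (+ 2 * A + N) * N)) (N * (N * N)) (A * (deficit i * deficit i)) ⟨
        N * (+ M * (A * A) + (+ 2 * A + N) * N) + N * (N * N) + A * (deficit i * deficit i) ∎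
        where
        P Q : Fin M → ℤ
        P j = gram i j ⁺ * gram i j ⁺
        Q j = (- gram i j) ⁺ * (- gram i j) ⁺

      N*∑∑gram²≤ : N * ∑[ i < M ] ∑[ j < M ] (gram i j * gram i j) ≤ + M * frobenius-majorant (+ M) N A
      N*∑∑gram²≤ = begin
        N * ∑[ i < M ] ∑[ j < M ] (gram i j * gram i j)          ≡⟨ FinSum.∫-*ˡ N (λ i → ∑[ j < M ] (gram i j * gram i j)) ⟨
        ∑[ i < M ] (N * ∑[ j < M ] (gram i j * gram i j))        ≤⟨ ∑-mono-≤ N*∑gram²≤ ⟩
        ∑[ i < M ] (C + A * (deficit i * deficit i))             ≡⟨ FinSum.∫-+ (λ _ → C) (λ i → A * (deficit i * deficit i)) ⟩
        ∑[ i < M ] C + ∑[ i < M ] (A * (deficit i * deficit i))  ≡⟨ cong₂ _+_ (∑-const M C) (FinSum.∫-*ˡ A (λ i → deficit i * deficit i)) ⟩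
        + M * C + A * ∑[ i < M ] (deficit i * deficit i)         ≤⟨ +-monoʳ-≤ (+ M * C) (*-monoˡ-≤-0≤ A 0≤A ∑deficit²≤) ⟩
        + M * C + A * (+ M * (K * K))                            ≡⟨ e (+ M) C A (K * K) ⟩
        + M * frobenius-majorant (+ M) N A                       ∎
        where
        C : ℤ
        C = N * (+ M * (A * A) + (+ 2 * A + N) * N) + N * (N * N)
        e : ∀ m C A k → m * C + A * (m * k) ≡ m * (C + A * k)
        e = solve-∀

  -- The block-sum-zero subspace of ℤ^(r×q)

  module Simplex (q : ℕ) where

    Q : ℤ
    Q = + q

    simplex : Fin q → Fin q → ℤ
    simplex a b = Q * δ a b - 1ℤ

    ∑-*simplex : ∀ (g : Fin q → ℤ) a → ∑[ b < q ] (g b * simplex a b) ≡ Q * g a - sum g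
    ∑-*simplex g a = begin-equality
      ∑[ b < q ] (g b * simplex a b)                    ≡⟨ sum-cong-≗ (λ b → e Q (g b) (δ a b)) ⟩
      ∑[ b < q ] (Q * (δ a b * g b) + - 1ℤ * g b)       ≡⟨ FinSum.∫-linear₂ Q (- 1ℤ) (λ b → δ a b * g b) g ⟩
      Q * ∑[ b < q ] (δ a b * g b) + - 1ℤ * sum g       ≡⟨ cong (λ x → Q * x + - 1ℤ * sum g) (∑-δ a g) ⟩
      Q * g a + - 1ℤ * sum g                            ≡⟨ cong (_+_ (Q * g a)) (-1*i≡-i (sum g)) ⟩
      Q * g a - sum g                                   ∎
      where
      e : ∀ Q g d → g * (Q * d - 1ℤ) ≡ Q * (d * g) + - 1ℤ * g
      e = solve-∀

    ∑-simplex : ∀ a → sum (simplex a) ≡ 0ℤ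
    ∑-simplex a = begin-equality
      sum (simplex a)                   ≡⟨ sum-cong-≗ (λ b → sym (*-identityˡ (simplex a b))) ⟩
      ∑[ b < q ] (1ℤ * simplex a b)     ≡⟨ ∑-*simplex (λ _ → 1ℤ) a ⟩
      Q * 1ℤ - ∑[ b < q ] 1ℤ            ≡⟨ cong (λ x → Q * 1ℤ - x) (∑-const q 1ℤ) ⟩
      Q * 1ℤ - Q * 1ℤ                   ≡⟨ +-inverseʳ (Q * 1ℤ) ⟩
      0ℤ                                ∎

    ∑simplex*simplex : ∀ a c → ∑[ b < q ] (simplex c b * simplex a b) ≡ Q * simplex c a
    ∑simplex*simplex a c = trans (∑-*simplex (simplex c) a)
      (trans (cong (λ x → Q * simplex c a - x) (∑-simplex c)) (+-identityʳ _))

  module Blocks (q r : ℕ) where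

    open Simplex q

    coords : Integral (Fin r × Fin q)
    coords = counting r ⊗ counting q

    private
      module μ = IntegralProperties coords
      module μ² = IntegralProperties (coords ⊗ coords)

    BlockSumZero : (Fin r × Fin q → ℤ) → Set
    BlockSumZero f = ∀ p → ∑[ a < q ] f (p , a) ≡ 0ℤ

    -- q times the orthogonal projection onto the block-sum-zero subspace, of dimension (q - 1) r.
    kernel : (Fin r × Fin q) × (Fin r × Fin q) → ℤ
    kernel ((p , a) , (p′ , b)) = δ p p′ * simplex a b

    ∫f*f*kernel : ∀ f → BlockSumZero f →
      μ².∫ (λ kl → f (proj₁ kl) * f (proj₂ kl) * kernel kl) ≡ Q * μ.∫ (λ k → f k * f k)
    ∫f*f*kernel f f-zero = trans (μ.∫-cong inner) (μ.∫-*ˡ Q (λ k → f k * f k))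
      where
      e : ∀ x y d s → x * y * (d * s) ≡ d * (x * (y * s))
      e = solve-∀
      inner : ∀ k → ∑[ p′ < r ] ∑[ b < q ] (f k * f (p′ , b) * kernel (k , (p′ , b))) ≡ Q * (f k * f k)
      inner (p , a) = begin-equality
        ∑[ p′ < r ] ∑[ b < q ] (f (p , a) * f (p′ , b) * (δ p p′ * simplex a b))
            ≡⟨ sum-cong-≗ (λ p′ → trans (sum-cong-≗ (λ b → e (f (p , a)) (f (p′ , b)) (δ p p′) (simplex a b)))
                   (trans (FinSum.∫-*ˡ (δ p p′) (λ b → f (p , a) * (f (p′ , b) * simplex a b)))
                     (cong (δ p p′ *_) (FinSum.∫-*ˡ (f (p , a)) (λ b → f (p′ , b) * simplex a b))))) ⟩
        ∑[ p′ < r ] (δ p p′ * (f (p , a) * ∑[ b < q ] (f (p′ , b) * simplex a b)))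
            ≡⟨ ∑-δ p (λ p′ → f (p , a) * ∑[ b < q ] (f (p′ , b) * simplex a b)) ⟩
        f (p , a) * ∑[ b < q ] (f (p , b) * simplex a b)
            ≡⟨ cong (f (p , a) *_) (trans (∑-*simplex (λ b → f (p , b)) a) (cong (λ x → Q * f (p , a) - x) (f-zero p))) ⟩
        f (p , a) * (Q * f (p , a) - 0ℤ)
            ≡⟨ e′ Q (f (p , a)) ⟩
        Q * (f (p , a) * f (p , a)) ∎
        where
        e′ : ∀ Q x → x * (Q * x - 0ℤ) ≡ Q * (x * x)
        e′ = solve-∀

    ∫kernel² : μ².∫ (λ kl → kernel kl * kernel kl) ≡ Q * Q * ((Q - 1ℤ) * + r)
    ∫kernel² = begin-equality
      μ².∫ (λ kl → kernel kl * kernel kl)         ≡⟨ μ.∫-cong inner ⟩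
      ∑[ p < r ] ∑[ a < q ] (Q * (Q - 1ℤ))       ≡⟨ sum-cong-≗ {r} (λ _ → ∑-const q (Q * (Q - 1ℤ))) ⟩
      ∑[ p < r ] (Q * (Q * (Q - 1ℤ)))             ≡⟨ ∑-const r (Q * (Q * (Q - 1ℤ))) ⟩
      + r * (Q * (Q * (Q - 1ℤ)))                  ≡⟨ e Q (+ r) ⟩
      Q * Q * ((Q - 1ℤ) * + r)                    ∎
      where
      e : ∀ Q r → r * (Q * (Q * (Q - 1ℤ))) ≡ Q * Q * ((Q - 1ℤ) * r)
      e = solve-∀
      e′ : ∀ d s → d * s * (d * s) ≡ (d * d) * (s * s)
      e′ = solve-∀
      inner : ∀ k → ∑[ p′ < r ] ∑[ b < q ] (kernel (k , (p′ , b)) * kernel (k , (p′ , b))) ≡ Q * (Q - 1ℤ)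
      inner (p , a) = begin-equality
        ∑[ p′ < r ] ∑[ b < q ] (δ p p′ * simplex a b * (δ p p′ * simplex a b))
            ≡⟨ sum-cong-≗ (λ p′ → trans (sum-cong-≗ (λ b → trans (e′ (δ p p′) (simplex a b)) (cong (_* (simplex a b * simplex a b)) (δ*δ≡δ p p′))))
                   (FinSum.∫-*ˡ (δ p p′) (λ b → simplex a b * simplex a b))) ⟩
        ∑[ p′ < r ] (δ p p′ * ∑[ b < q ] (simplex a b * simplex a b))
            ≡⟨ ∑-δ p (λ _ → ∑[ b < q ] (simplex a b * simplex a b)) ⟩
        ∑[ b < q ] (simplex a b * simplex a b)
            ≡⟨ ∑simplex*simplex a a ⟩
        Q * (Q * δ a a - 1ℤ)
            ≡⟨ cong (λ d → Q * (Q * d - 1ℤ)) (δ-refl a) ⟩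
        Q * (Q * 1ℤ - 1ℤ)
            ≡⟨ cong (λ x → Q * (x - 1ℤ)) (*-identityʳ Q) ⟩
        Q * (Q - 1ℤ) ∎

    module _ {M : ℕ} (v : Fin M → Fin r × Fin q → ℤ) (v-zero : ∀ i → BlockSumZero (v i)) where

      open GramSystem coords v

      trace-bound : 0ℤ < Q →
        (∑[ i < M ] gram i i) * (∑[ i < M ] gram i i) ≤ ((Q - 1ℤ) * + r) * ∑[ i < M ] ∑[ j < M ] (gram i j * gram i j)
      trace-bound 0<Q = *-cancelˡ-≤-0< (Q * Q) (0<i*j 0<Q 0<Q) (begin
        Q * Q * (T * T)                                         ≡⟨ e Q T ⟩
        (Q * T) * (Q * T)                                       ≡⟨ cong (λ x → x * x) (sym ∫outer*kernel) ⟩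
        μ².∫ outer*kernel * μ².∫ outer*kernel                   ≤⟨ μ².cauchy-schwarz outer kernel ⟩
        μ².∫ (λ kl → outer kl * outer kl) * μ².∫ (λ kl → kernel kl * kernel kl)
                                                                ≡⟨ cong₂ _*_ ∫outer²≡∑gram² ∫kernel² ⟩
        F * (Q * Q * ((Q - 1ℤ) * + r))                          ≡⟨ e′ F (Q * Q) ((Q - 1ℤ) * + r) ⟩
        Q * Q * (((Q - 1ℤ) * + r) * F)                          ∎)
        where
        T F : ℤ
        T = ∑[ i < M ] gram i i
        F = ∑[ i < M ] ∑[ j < M ] (gram i j * gram i j)
        outer*kernel : (Fin r × Fin q) × (Fin r × Fin q) → ℤ
        outer*kernel kl = outer kl * kernel kl
        e : ∀ Q T → Q * Q * (T * T) ≡ (Q * T) * (Q * T)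
        e = solve-∀
        e′ : ∀ F a b → F * (a * b) ≡ a * (b * F)
        e′ = solve-∀
        ∫outer*kernel : μ².∫ outer*kernel ≡ Q * T
        ∫outer*kernel = begin-equality
          μ².∫ outer*kernel
            ≡⟨ μ².∫-cong (λ kl → *-distribʳ-sum (kernel kl) (λ i → v i (proj₁ kl) * v i (proj₂ kl))) ⟩
          μ².∫ (λ kl → ∑[ i < M ] (v i (proj₁ kl) * v i (proj₂ kl) * kernel kl))
            ≡⟨ μ².∫-∑-comm M (λ kl i → v i (proj₁ kl) * v i (proj₂ kl) * kernel kl) ⟩
          ∑[ i < M ] μ².∫ (λ kl → v i (proj₁ kl) * v i (proj₂ kl) * kernel kl)
            ≡⟨ sum-cong-≗ (λ i → ∫f*f*kernel (v i) (v-zero i)) ⟩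
          ∑[ i < M ] (Q * gram i i)
            ≡⟨ FinSum.∫-*ˡ Q (λ i → gram i i) ⟩
          Q * T ∎

  -- Codes

  AllPairs-lookup : ∀ {A : Set} {R : A → A → Set} → (∀ {x y} → R x y → R y x) →
    ∀ {xs} → AllPairs R xs → ∀ {i j} → ¬ i ≡ j → R (List.lookup xs i) (List.lookup xs j)
  AllPairs-lookup R-sym (_ ∷ _) {zero} {zero} i≢j = contradiction refl i≢j
  AllPairs-lookup R-sym (Rx ∷ _) {zero} {suc j} _ = All.lookup Rx (∈-lookup j)
  AllPairs-lookup R-sym (Rx ∷ _) {suc i} {zero} _ = R-sym (All.lookup Rx (∈-lookup i))
  AllPairs-lookup R-sym (_ ∷ Rxs) {suc i} {suc j} i≢j = AllPairs-lookup R-sym Rxs (i≢j ∘ cong suc)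

  hamming-comm : ∀ {q r} (x y : Vec (Fin q) r) → hamming x y ≡ hamming y x
  hamming-comm [] [] = refl
  hamming-comm (a ∷ x) (b ∷ y) with a ≟ b | b ≟ a
  ... | yes _   | yes _   = hamming-comm x y
  ... | no _    | no _    = cong suc (hamming-comm x y)
  ... | yes a≡b | no b≢a  = contradiction (sym a≡b) b≢a
  ... | no a≢b  | yes b≡a = contradiction (sym b≡a) a≢b

  hamming-refl : ∀ {q r} (x : Vec (Fin q) r) → hamming x x ≡ 0
  hamming-refl [] = refl
  hamming-refl (a ∷ x) with a ≟ a
  ... | yes _ = hamming-refl x
  ... | no a≢a = contradiction refl a≢a

  agreements : ∀ {q r} → Vec (Fin q) r → Vec (Fin q) r → ℤ
  agreements {r = r} x y = ∑[ p < r ] δ (lookup x p) (lookup y p)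

  agreements+hamming≡r : ∀ {q r} (x y : Vec (Fin q) r) → agreements x y + + hamming x y ≡ + r
  agreements+hamming≡r [] [] = refl
  agreements+hamming≡r (a ∷ x) (b ∷ y) with a ≟ b
  ... | yes _ = trans (+-assoc 1ℤ (agreements x y) (+ hamming x y)) (cong (_+_ 1ℤ) (agreements+hamming≡r x y))
  ... | no _ = trans (e (agreements x y) (+ hamming x y)) (cong (_+_ 1ℤ) (agreements+hamming≡r x y))
    where
    e : ∀ s h → 0ℤ + s + (1ℤ + h) ≡ 1ℤ + (s + h)
    e = solve-∀

  module Embedding (q r : ℕ) where

    open Simplex q
    open Blocks q r

    dimension : ℤ
    dimension = (Q - 1ℤ) * + r

    -- In the paper's notation s = (1 - 1/q) r - j, so gap s = q j.
    gap : ℕ → ℤ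
    gap s = dimension - Q * + s

    embed : Vec (Fin q) r → Fin r × Fin q → ℤ
    embed x (p , a) = simplex (lookup x p) a

    embed-blockSumZero : ∀ x → BlockSumZero (embed x)
    embed-blockSumZero x p = ∑-simplex (lookup x p)

    ⟨embed,embed⟩ : ∀ x y →
      Integral.∫ coords (λ k → embed x k * embed y k) ≡ Q * (dimension - Q * + hamming x y)
    ⟨embed,embed⟩ x y = begin-equality
      ∑[ p < r ] ∑[ a < q ] (simplex (lookup x p) a * simplex (lookup y p) a)
          ≡⟨ sum-cong-≗ (λ p → trans (∑simplex*simplex (lookup y p) (lookup x p)) (e Q (δ (lookup x p) (lookup y p)))) ⟩
      ∑[ p < r ] (Q * Q * δ (lookup x p) (lookup y p) + - Q * 1ℤ)
          ≡⟨ FinSum.∫-linear₂ (Q * Q) (- Q) (λ p → δ (lookup x p) (lookup y p)) (λ _ → 1ℤ) ⟩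
      Q * Q * ∑[ p < r ] δ (lookup x p) (lookup y p) + - Q * ∑[ p < r ] 1ℤ
          ≡⟨ cong₂ (λ a b → Q * Q * a + - Q * b) agreements≡r-hamming (∑-const r 1ℤ) ⟩
      Q * Q * (+ r - + hamming x y) + - Q * (+ r * 1ℤ)
          ≡⟨ e′ Q (+ r) (+ hamming x y) ⟩
      Q * (dimension - Q * + hamming x y) ∎
      where
      e : ∀ Q d → Q * (Q * d - 1ℤ) ≡ Q * Q * d + - Q * 1ℤ
      e = solve-∀
      e′ : ∀ Q r h → Q * Q * (r - h) + - Q * (r * 1ℤ) ≡ Q * ((Q - 1ℤ) * r - Q * h)
      e′ = solve-∀
      e″ : ∀ s h → s + h - h ≡ s
      e″ = solve-∀
      agreements≡r-hamming : agreements x y ≡ + r - + hamming x y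
      agreements≡r-hamming = trans (sym (e″ _ (+ hamming x y))) (cong (_- + hamming x y) (agreements+hamming≡r x y))

    module _ {s : ℕ} {C : List (Vec (Fin q) r)} (code : IsCode q r s C) where

      open GramSystem coords (λ i → embed (List.lookup C i))

      gram-diag : ∀ i → gram i i ≡ Q * dimension
      gram-diag i = begin-equality
        gram i i                             ≡⟨ ⟨embed,embed⟩ x x ⟩
        Q * (dimension - Q * + hamming x x)  ≡⟨ cong (λ h → Q * (dimension - Q * + h)) (hamming-refl x) ⟩
        Q * (dimension - Q * 0ℤ)             ≡⟨ e Q dimension ⟩
        Q * dimension                        ∎
        where
        x : Vec (Fin q) r
        x = List.lookup C i
        e : ∀ Q n → Q * (n - Q * 0ℤ) ≡ Q * n
        e = solve-∀

      gram-off : ∀ {i j} → ¬ i ≡ j → gram i j ≤ Q * gap s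
      gram-off {i} {j} i≢j = begin
        gram i j                             ≡⟨ ⟨embed,embed⟩ x y ⟩
        Q * (dimension - Q * + hamming x y)  ≤⟨ *-monoˡ-≤-0≤ Q (+≤+ ℕ.z≤n) (+-monoʳ-≤ dimension (neg-mono-≤ (*-monoˡ-≤-0≤ Q (+≤+ ℕ.z≤n) (+≤+ s≤d)))) ⟩
        Q * gap s                            ∎
        where
        x y : Vec (Fin q) r
        x = List.lookup C i
        y = List.lookup C j
        separated-sym : ∀ {x y : Vec (Fin q) r} → ¬ x ≡ y × s ℕ.≤ hamming x y → ¬ y ≡ x × s ℕ.≤ hamming y x
        separated-sym {x} {y} (x≢y , s≤d) = x≢y ∘ sym , subst (s ℕ.≤_) (hamming-comm x y) s≤d
        s≤d : s ℕ.≤ hamming x y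
        s≤d = proj₂ (AllPairs-lookup separated-sym code i≢j)

      code-inequality : 0ℤ < Q → 0ℤ < dimension → 0ℤ ≤ gap s → 0 ℕ.< List.length C →
        + List.length C * (dimension * dimension) ≤ frobenius-majorant (+ List.length C) dimension (gap s)
      code-inequality 0<Q 0<n 0≤t 0<M = *-cancelˡ-≤-0< c 0<c (begin
        c * (m * (n * n))                             ≡⟨ e₁ Q n m ⟩
        N * (m * N * (m * N))                         ≡⟨ cong (λ T → N * (T * T)) (sym trace≡m*N) ⟩
        N * (T * T)                                   ≤⟨ *-monoˡ-≤-0≤ N (<⇒≤ 0<N) (trace-bound v v-zero 0<Q) ⟩
        N * (n * F)                                   ≡⟨ e₂ N n F ⟩
        n * (N * F)                                   ≤⟨ *-monoˡ-≤-0≤ n (<⇒≤ 0<n) (N*∑∑gram²≤ 0<N 0≤A gram-diag gram-off) ⟩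
        n * (m * frobenius-majorant m N A)            ≡⟨ cong (λ x → n * (m * x)) (frobenius-majorant-homogeneous m Q n t) ⟩
        n * (m * (Q * Q * Q * frobenius-majorant m n t)) ≡⟨ e₃ Q n m (frobenius-majorant m n t) ⟩
        c * frobenius-majorant m n t                  ∎)
        where
        v : Fin (List.length C) → Fin r × Fin q → ℤ
        v i = embed (List.lookup C i)
        v-zero : ∀ i → BlockSumZero (v i)
        v-zero i = embed-blockSumZero (List.lookup C i)
        m n t N A c T F : ℤ
        m = + List.length C
        n = dimension
        t = gap s
        N = Q * n
        A = Q * t
        c = Q * Q * Q * n * m
        T = ∑[ i < List.length C ] gram i i
        F = ∑[ i < List.length C ] ∑[ j < List.length C ] (gram i j * gram i j)
        0<N : 0ℤ < N
        0<N = 0<i*j 0<Q 0<n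
        0≤A : 0ℤ ≤ A
        0≤A = 0≤i*j (<⇒≤ 0<Q) 0≤t
        0<c : 0ℤ < c
        0<c = 0<i*j (0<i*j (0<i*j (0<i*j 0<Q 0<Q) 0<Q) 0<n) (+<+ 0<M)
        trace≡m*N : T ≡ m * N
        trace≡m*N = trans (sum-cong-≗ gram-diag) (∑-const (List.length C) N)
        e₁ : ∀ Q n m → Q * Q * Q * n * m * (m * (n * n)) ≡ Q * n * (m * (Q * n) * (m * (Q * n)))
        e₁ = solve-∀
        e₂ : ∀ N n F → N * (n * F) ≡ n * (N * F)
        e₂ = solve-∀
        e₃ : ∀ Q n m R → n * (m * (Q * Q * Q * R)) ≡ Q * Q * Q * n * m * R
        e₃ = solve-∀

  cubic≤31t³ : ∀ t → 0ℤ ≤ t → + 3 * t + + 12 * (t * t) + + 16 * (t * t * t) ≤ + 31 * (t * t * t)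
  cubic≤31t³ +0 _ = ≤-refl
  cubic≤31t³ t@(+[1+ k ]) 0≤t = begin
    + 3 * t + + 12 * (t * t) + + 16 * (t * t * t)
        ≤⟨ +-monoˡ-≤ (+ 16 * (t * t * t)) (+-mono-≤ (*-monoˡ-≤-0≤ (+ 3) (+≤+ ℕ.z≤n) t≤t³) (*-monoˡ-≤-0≤ (+ 12) (+≤+ ℕ.z≤n) t²≤t³)) ⟩
    + 3 * (t * t * t) + + 12 * (t * t * t) + + 16 * (t * t * t)
        ≡⟨ e (t * t * t) ⟩
    + 31 * (t * t * t) ∎
    where
    1≤t : 1ℤ ≤ t
    1≤t = +≤+ (ℕ.s≤s ℕ.z≤n)
    t²≤t³ : t * t ≤ t * t * t
    t²≤t³ = i≤i*j (0≤i*i t) 1≤t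
    t≤t³ : t ≤ t * t * t
    t≤t³ = ≤-trans (i≤i*j 0≤t 1≤t) t²≤t³
    e : ∀ c → + 3 * c + + 12 * c + + 16 * c ≡ + 31 * c
    e = solve-∀

  size-bound : ∀ {m n t} → 0ℤ < n → 0ℤ ≤ t → 0ℤ ≤ m → m ≤ + 4 * n →
    m * (n * n) ≤ frobenius-majorant m n t → m ≤ + 2 * n + + 31 * (t * t * t)
  size-bound {m} {n} {t} 0<n 0≤t 0≤m m≤4n h = *-cancelˡ-≤-0< (n * n) (0<i*j 0<n 0<n) (begin
    n * n * m                           ≡⟨ *-comm (n * n) m ⟩
    m * (n * n)                         ≤⟨ h ⟩
    frobenius-majorant m n t            ≤⟨ frobenius-majorant-mono (<⇒≤ 0<n) 0≤t 0≤m m≤4n ⟩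
    frobenius-majorant (+ 4 * n) n t    ≡⟨ e n t ⟩
    n * n * (+ 2 * n + (+ 3 * t + + 12 * (t * t) + + 16 * (t * t * t)))
                                        ≤⟨ *-monoˡ-≤-0≤ (n * n) (0≤i*i n) (+-monoʳ-≤ (+ 2 * n) (cubic≤31t³ t 0≤t)) ⟩
    n * n * (+ 2 * n + + 31 * (t * t * t)) ∎)
    where
    e : ∀ n t →
      n * (+ 4 * n * (t * t) + (+ 2 * t + n) * n) + n * (n * n) + t * ((+ 4 * n * t + n) * (+ 4 * n * t + n))
      ≡ n * n * (+ 2 * n + (+ 3 * t + + 12 * (t * t) + + 16 * (t * t * t)))
    e = solve-∀

  code-size-bound : ∀ {q r s} {C : List (Vec (Fin q) r)} → IsCode q r s C →
    1 ℕ.≤ q → 1 ℕ.≤ (q ℕ.∸ 1) ℕ.* r → q ℕ.* s ℕ.≤ (q ℕ.∸ 1) ℕ.* r →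
    List.length C ℕ.≤ 4 ℕ.* ((q ℕ.∸ 1) ℕ.* r) →
    List.length C ℕ.≤ 2 ℕ.* ((q ℕ.∸ 1) ℕ.* r) ℕ.+ 31 ℕ.* ((q ℕ.∸ 1) ℕ.* r ℕ.∸ q ℕ.* s) ℕ.^ 3
  code-size-bound {C = List.[]} _ _ _ _ _ = ℕ.z≤n
  code-size-bound {q} {r} {s} {C = C@(_ List.∷ _)} code 1≤q 1≤n qs≤n M≤4n =
    drop‿+≤+ (subst (+ List.length C ≤_) (sym cast)
      (size-bound 0<dim 0≤gap (+≤+ ℕ.z≤n) M≤4dim (code-inequality code 0<Q 0<dim 0≤gap (ℕ.s≤s ℕ.z≤n))))
    where
    open Simplex q using (Q)
    open Embedding q r
    n t : ℕ
    n = (q ℕ.∸ 1) ℕ.* r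
    t = n ℕ.∸ q ℕ.* s
    n≡dim : + n ≡ dimension
    n≡dim = trans (pos-* (q ℕ.∸ 1) r) (cong (_* + r) (pos-∸ 1≤q))
    t≡gap : + t ≡ gap s
    t≡gap = trans (pos-∸ qs≤n) (cong₂ _-_ n≡dim (pos-* q s))
    0<Q : 0ℤ < Q
    0<Q = +<+ 1≤q
    0<dim : 0ℤ < dimension
    0<dim = subst (0ℤ <_) n≡dim (+<+ 1≤n)
    0≤gap : 0ℤ ≤ gap s
    0≤gap = subst (0ℤ ≤_) t≡gap (+≤+ ℕ.z≤n)
    M≤4dim : + List.length C ≤ + 4 * dimension
    M≤4dim = subst (+ List.length C ≤_) (trans (pos-* 4 n) (cong (+ 4 *_) n≡dim)) (+≤+ M≤4n)
    cast : + (2 ℕ.* n ℕ.+ 31 ℕ.* t ℕ.^ 3) ≡ + 2 * dimension + + 31 * (gap s * gap s * gap s)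
    cast = begin-equality
      + (2 ℕ.* n ℕ.+ 31 ℕ.* t ℕ.^ 3)        ≡⟨ pos-+ (2 ℕ.* n) (31 ℕ.* t ℕ.^ 3) ⟩
      + (2 ℕ.* n) + + (31 ℕ.* t ℕ.^ 3)      ≡⟨ cong₂ _+_ (pos-* 2 n) (trans (pos-* 31 (t ℕ.^ 3)) (cong (+ 31 *_) (pos-cube t))) ⟩
      + 2 * + n + + 31 * (+ t * + t * + t)  ≡⟨ cong₂ (λ a b → + 2 * a + + 31 * (b * b * b)) n≡dim t≡gap ⟩
      + 2 * dimension + + 31 * (gap s * gap s * gap s) ∎

open import Data.Nat using (ℕ; suc; _+_; _*_; _∸_; _^_; _≤_)
open import Data.Fin using (Fin)
open import Data.Vec using (Vec)
open import Data.List using (List; length)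
open import Data.Product using (_×_; ∃-syntax)

open GramMatrixBound using (code-size-bound)
open import Data.Nat using (z≤n; s≤s; _<_; _≤?_; NonZero; >-nonZero)
open import Data.Nat.Properties
open import Data.Nat.Tactic.RingSolver using (solve-∀)
open import Data.List using (take)
open import Data.List.Properties using (length-take)
open import Data.List.Relation.Unary.AllPairs.Properties using (take⁺)
open import Data.Product using (_,_; proj₁; proj₂)
open import Relation.Binary.PropositionalEquality
open import Relation.Nullary using (yes; no)
open import Relation.Nullary.Negation using (contradiction)
open ≤-Reasoning

-- A longer code would have a prefix of length exactly 4n, which code-size-bound rules out.
code-length≤4n : ∀ {q r s} {C : List (Vec (Fin q) r)} → IsCode q r s C →
  1 ≤ q → 1 ≤ (q ∸ 1) * r → q * s ≤ (q ∸ 1) * r →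
  31 * ((q ∸ 1) * r ∸ q * s) ^ 3 < 2 * ((q ∸ 1) * r) →
  length C ≤ 4 * ((q ∸ 1) * r)
code-length≤4n {q} {r} {s} {C} code 1≤q 1≤n qs≤n small with length C ≤? 4 * ((q ∸ 1) * r)
... | yes M≤4n = M≤4n
... | no M≰4n = contradiction prefix-bound (<⇒≱ (begin-strict
  2 * n + c       <⟨ +-monoʳ-< (2 * n) small ⟩
  2 * n + 2 * n   ≡⟨ e n ⟩
  4 * n           ∎))
  where
  n c : ℕ
  n = (q ∸ 1) * r
  c = 31 * (n ∸ q * s) ^ 3
  |prefix|≡4n : length (take (4 * n) C) ≡ 4 * n
  |prefix|≡4n = trans (length-take (4 * n) C) (m≤n⇒m⊓n≡m (<⇒≤ (≰⇒> M≰4n)))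
  prefix-bound : 4 * n ≤ 2 * n + c
  prefix-bound = subst (_≤ 2 * n + c) |prefix|≡4n
    (code-size-bound (take⁺ (4 * n) code) 1≤q 1≤n qs≤n (≤-reflexive |prefix|≡4n))
  e : ∀ n → 2 * n + 2 * n ≡ 4 * n
  e = solve-∀

scaled-bound : ∀ k n c M → M ≤ 2 * n + c → suc k * c ≤ n → suc k * M ≤ (2 * suc k + 1) * n
scaled-bound k n c M M≤2n+c [1+k]c≤n = begin
  suc k * M                    ≤⟨ *-monoʳ-≤ (suc k) M≤2n+c ⟩
  suc k * (2 * n + c)          ≡⟨ *-distribˡ-+ (suc k) (2 * n) c ⟩
  suc k * (2 * n) + suc k * c  ≤⟨ +-monoʳ-≤ (suc k * (2 * n)) [1+k]c≤n ⟩
  suc k * (2 * n) + n          ≡⟨ e (suc k) n ⟩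
  (2 * suc k + 1) * n          ∎
  where
  e : ∀ m n → m * (2 * n) + n ≡ (2 * m + 1) * n
  e = solve-∀

code-bound : ∀ k {q r s} {C : List (Vec (Fin q) r)} → IsCode q r s C →
  2 ≤ q → 1 ≤ r → q * s ≤ (q ∸ 1) * r →
  suc k * (31 * ((q ∸ 1) * r ∸ q * s) ^ 3) ≤ (q ∸ 1) * r →
  suc k * length C ≤ (2 * suc k + 1) * ((q ∸ 1) * r)
code-bound k {q} {r} {s} {C} code 2≤q 1≤r qs≤n [1+k]c≤n =
  scaled-bound k n c (length C) (code-size-bound code 1≤q 1≤n qs≤n M≤4n) [1+k]c≤n
  where
  n c : ℕ
  n = (q ∸ 1) * r
  c = 31 * (n ∸ q * s) ^ 3
  1≤q : 1 ≤ q
  1≤q = ≤-trans (s≤s z≤n) 2≤q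
  1≤n : 1 ≤ n
  1≤n = *-mono-≤ (∸-monoˡ-≤ 1 2≤q) 1≤r
  c<2n : c < 2 * n
  c<2n = begin-strict
    c          ≤⟨ m≤n*m c (suc k) ⟩
    suc k * c  ≤⟨ [1+k]c≤n ⟩
    n          <⟨ m<m+n n 1≤n ⟩
    n + n      ≡⟨ cong (n +_) (+-identityʳ n) ⟨
    2 * n      ∎
  M≤4n : length C ≤ 4 * n
  M≤4n = code-length≤4n code 1≤q 1≤n qs≤n c<2n

cube-bound : ∀ q k r t → .{{NonZero q}} →
  suc (31 * (suc k * q ^ 3)) * t ^ 3 ≤ q ^ 3 * r → suc k * (31 * t ^ 3) ≤ r
cube-bound q k r t h = *-cancelˡ-≤ (q ^ 3) {{m^n≢0 q 3}} (begin
  q ^ 3 * (suc k * (31 * t ^ 3))        ≡⟨ e (q ^ 3) (suc k) (t ^ 3) ⟩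
  31 * (suc k * q ^ 3) * t ^ 3          ≤⟨ m≤n+m _ (t ^ 3) ⟩
  suc (31 * (suc k * q ^ 3)) * t ^ 3    ≤⟨ h ⟩
  q ^ 3 * r                             ∎)
  where
  e : ∀ y m x → y * (m * (31 * x)) ≡ 31 * (m * y) * x
  e = solve-∀

theorem1p3 : (q : ℕ) → 2 ≤ q → (s : ℕ → ℕ)
    → (∀ r → 1 ≤ r → 1 ≤ s r × q * s r ≤ (q ∸ 1) * r)
    → (∀ k → ∃[ R ] (∀ r → R ≤ r → suc k * ((q ∸ 1) * r ∸ q * s r) ^ 3 ≤ q ^ 3 * r))
    → ∀ k → ∃[ R ] (∀ r → R ≤ r → (C : List (Vec (Fin q) r)) → IsCode q r (s r) C
      → suc k * length C ≤ (2 * suc k + 1) * ((q ∸ 1) * r))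
theorem1p3 q 2≤q s hs hyp k = suc R , λ r R<r C code →
  code-bound k code 2≤q (1≤r R<r) (proj₂ (hs r (1≤r R<r))) (small-gap r R<r)
  where
  K R : ℕ
  K = 31 * (suc k * q ^ 3)
  R = proj₁ (hyp K)
  1≤r : ∀ {r} → suc R ≤ r → 1 ≤ r
  1≤r R<r = ≤-trans (s≤s z≤n) R<r
  small-gap : ∀ r → suc R ≤ r → suc k * (31 * ((q ∸ 1) * r ∸ q * s r) ^ 3) ≤ (q ∸ 1) * r
  small-gap r R<r = ≤-trans
    (cube-bound q k r ((q ∸ 1) * r ∸ q * s r) {{>-nonZero (≤-trans (s≤s z≤n) 2≤q)}} (proj₂ (hyp K) r (≤-trans (n≤1+n R) R<r)))
    (m≤n*m r (q ∸ 1) {{>-nonZero (∸-monoˡ-≤ 1 2≤q)}})
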